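{- Fix $k\ge2$, write $A_xy=A_x(k,y)$, and let $m>0$ have $k$-sandwiching sequence $(a_i,b_i)_{i=1}^n$ with sandwiching values $(m_i)_{i\le n}$. Then for every $i\in[1,n)$: (1) $b_{i+1}<\min\{A_{a_{i+1}}^{k-1}A_{a_{i+1}+1}(m_i-1),\ A_{a_i-1}^{k-1}m_i\}$; (2) $A_{a_{i+1}}(b_{i+1}+1)\le A_{a_{i+1}+1}m_i$; and (3) $A_{a_{i+1}}(b_{i+1}+1)\le A_{a_i}(b_i+1)$.
   Context: Ackermann function: for $k\ge 2$, $a,b\ge 0$: $A_a(k,-1):=1$, $A_0(k,b):=k^b$, $A_{a+1}(k,b):=A_a(k,\cdot)^k(A_{a+1}(k,b-1))$; $A_x^jy$ denotes the $j$-fold iterate of $y\mapsto A_xy$. $k$-normal form and sandwiching: for $m>0$, $m\equiv_k A_ab+c$ means $m=A_ab+c$ and there exist $n\ge1$ and naturals $a_1..a_n$, $b_1..b_n$, $m_0..m_n$ (sandwiching values) with $m_0=0$; for $0\le i<n$: $A_{a_{i+1}}m_i\le m<A_{a_{i+1}+1}m_i$, $A_{a_{i+1}}b_{i+1}\le m<A_{a_{i+1}}(b_{i+1}+1)$, $m_{i+1}=A_{a_{i+1}}b_{i+1}$; $A_0m_n>m$; $a=a_n$, $b=b_n$. The sequence $(a_i,b_i)_{i=1}^n$ is the $k$-sandwiching sequence of $m$ (uniquely determined by $m$). -}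

module Defs where

open import Data.Nat using (ℕ; zero; suc; _^_; _≤_; _<_)
open import Relation.Binary.PropositionalEquality using (_≡_)

iter : ℕ → (ℕ → ℕ) → ℕ → ℕ
iter zero    f y = y
iter (suc j) f y = f (iter j f y)

-- Ackermann function A_a(k,b) for b ≥ 0.
-- The paper's convention A_a(k,-1) = 1 is built in: A_{a+1}(k,0) = A_a(k,·)^k (1).
Ack : ℕ → ℕ → ℕ → ℕ
Ack k zero    b       = k ^ b
Ack k (suc a) zero    = iter k (Ack k a) 1
Ack k (suc a) (suc b) = iter k (Ack k a) (Ack k (suc a) b)

-- (a i, b i) for 1 ≤ i ≤ n is a k-sandwiching sequence of m with sandwiching
-- values ms 0, …, ms n (values of a, b, ms at other indices are irrelevant).
record Sandwiching (k m n : ℕ) (a b ms : ℕ → ℕ) : Set where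
  field
    n≥1   : 1 ≤ n
    ms0   : ms 0 ≡ 0
    lowA  : ∀ i → i < n → Ack k (a (suc i)) (ms i) ≤ m
    upA   : ∀ i → i < n → m < Ack k (suc (a (suc i))) (ms i)
    lowB  : ∀ i → i < n → Ack k (a (suc i)) (b (suc i)) ≤ m
    upB   : ∀ i → i < n → m < Ack k (a (suc i)) (suc (b (suc i)))
    step  : ∀ i → i < n → ms (suc i) ≡ Ack k (a (suc i)) (b (suc i))
    stop  : m < Ack k 0 (ms n)

-- Sandwiching forces a_{i+1} < a_i, so a_i = c + 1 for some c, and
-- m_i > 0. Unfolding the recursion once gives A_{a_{i+1}+1} m_i = A_{a_{i+1}} X and
-- A_{a_i}(b_i + 1) = A_c Y, where X = A_{a_{i+1}}^{k-1} A_{a_{i+1}+1}(m_i − 1) and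
-- Y = A_c^{k-1} m_i. Since A_{a_{i+1}} b_{i+1} ≤ m lies below both, strict monotonicity
-- of each A_a yields b_{i+1} < X and b_{i+1} < Y (when a_{i+1} < c one passes through
-- X < A_{a_{i+1}+1} m_i ≤ A_c m_i ≤ Y), and the bounds (2), (3) follow by monotonicity
-- in both arguments.
module Submission where

open import Defs
open import Data.Nat using (ℕ; zero; suc; _+_; _∸_; _⊓_; _≤_; _<_; _≤′_; ≤′-refl; ≤′-step; z≤n; s≤s)
open import Data.Nat.Properties
open import Data.Product using (_×_; _,_)
open import Data.Sum using (inj₁; inj₂)
open import Relation.Binary.PropositionalEquality using (_≡_; refl; sym; cong; subst)

module _ (f : ℕ → ℕ) where

  stepwise-mono : (∀ n → f n ≤ f (suc n)) → ∀ {m n} → m ≤ n → f m ≤ f n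
  stepwise-mono f-step {m} m≤n = go (≤⇒≤′ m≤n)
    where
    go : ∀ {n} → m ≤′ n → f m ≤ f n
    go ≤′-refl       = ≤-refl
    go (≤′-step m≤n) = ≤-trans (go m≤n) (f-step _)

  mono-cancel-< : (∀ {m n} → m ≤ n → f m ≤ f n) → ∀ {m n} → f m < f n → m < n
  mono-cancel-< f-mono fm<fn = ≰⇒> (λ n≤m → <⇒≱ fm<fn (f-mono n≤m))

  module _ (f-inflationary : ∀ y → y < f y) where

    iter-inflationary : ∀ j y → y ≤ iter j f y
    iter-inflationary zero    y = ≤-refl
    iter-inflationary (suc j) y = ≤-trans (iter-inflationary j y) (<⇒≤ (f-inflationary _))

    iter-suc-inflationary : ∀ j y → y < iter (suc j) f y
    iter-suc-inflationary j y = ≤-<-trans (iter-inflationary j y) (f-inflationary _)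

-- The base is 2 + k, so the paper's k − 1 iterations of A_a are suc k iterations here.
module _ (k : ℕ) where

  private
    A : ℕ → ℕ → ℕ
    A = Ack (2 + k)

  n<[2+k]^n : ∀ n → n < A 0 n
  n<[2+k]^n zero    = s≤s z≤n
  n<[2+k]^n (suc n) = ≤-<-trans (n<[2+k]^n n) (^-monoʳ-< (2 + k) (s≤s (s≤s z≤n)) (n<1+n n))

  Ack-inflationary : ∀ a b → b < A a b
  Ack-inflationary zero    b       = n<[2+k]^n b
  Ack-inflationary (suc a) zero    = ≤-<-trans z≤n (iter-suc-inflationary (A a) (Ack-inflationary a) (suc k) 1)
  Ack-inflationary (suc a) (suc b) = ≤-<-trans (Ack-inflationary (suc a) b)
    (iter-suc-inflationary (A a) (Ack-inflationary a) (suc k) (A (suc a) b))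

  Ack-<-sucʳ : ∀ a b → A a b < A a (suc b)
  Ack-<-sucʳ zero    b = ^-monoʳ-< (2 + k) (s≤s (s≤s z≤n)) (n<1+n b)
  Ack-<-sucʳ (suc a) b = iter-suc-inflationary (A a) (Ack-inflationary a) (suc k) (A (suc a) b)

  Ack-monoʳ-≤ : ∀ a {b b′} → b ≤ b′ → A a b ≤ A a b′
  Ack-monoʳ-≤ a = stepwise-mono (A a) (λ b → <⇒≤ (Ack-<-sucʳ a b))

  Ack-cancelʳ-< : ∀ a {b b′} → A a b < A a b′ → b < b′
  Ack-cancelʳ-< a = mono-cancel-< (A a) (Ack-monoʳ-≤ a)

  Ack-≤-sucˡ : ∀ a b → A a b ≤ A (suc a) b
  Ack-≤-sucˡ a zero    = Ack-monoʳ-≤ a z≤n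
  Ack-≤-sucˡ a (suc b) = Ack-monoʳ-≤ a (≤-trans (Ack-inflationary (suc a) b)
    (iter-inflationary (A a) (Ack-inflationary a) (suc k) (A (suc a) b)))

  Ack-monoˡ-≤ : ∀ {a a′} b → a ≤ a′ → A a b ≤ A a′ b
  Ack-monoˡ-≤ b = stepwise-mono (λ a → A a b) (λ a → Ack-≤-sucˡ a b)

  Ack-suc-unfold : ∀ a {x} → 0 < x → A (suc a) x ≡ A a (iter (suc k) (A a) (A (suc a) (x ∸ 1)))
  Ack-suc-unfold a {suc x} _ = refl

  sandwich-index-decreases : ∀ {a a′ b x m} → x ≡ A a b → A a′ x ≤ m → m < A a (suc b) → a′ < a
  sandwich-index-decreases {a} {a′} {b} {x} {m} x≡ lowA upB = ≰⇒> λ a≤a′ → <⇒≱ upB (begin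
    A a (suc b) ≤⟨ Ack-monoʳ-≤ a (subst (suc b ≤_) (sym x≡) (Ack-inflationary a b)) ⟩
    A a x       ≤⟨ Ack-monoˡ-≤ x a≤a′ ⟩
    A a′ x      ≤⟨ lowA ⟩
    m           ∎)
    where open ≤-Reasoning

  sandwich-bounds-below : ∀ {c a′ b b′ x m} → a′ ≤ c → x ≡ A (suc c) b →
    m < A (suc a′) x → A a′ b′ ≤ m → m < A (suc c) (suc b) →
      (b′ < iter (suc k) (A a′) (A (suc a′) (x ∸ 1)) ⊓ iter (suc k) (A c) x)
      × A a′ (suc b′) ≤ A (suc a′) x
      × A a′ (suc b′) ≤ A (suc c) (suc b)
  sandwich-bounds-below {c} {a′} {b} {b′} {x} {m} a′≤c x≡ upA lowB upB =
    ⊓-glb b′<X b′<Y , subst (A a′ (suc b′) ≤_) (sym unfold-x) (Ack-monoʳ-≤ a′ b′<X) ,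
    subst (A a′ (suc b′) ≤_) (sym unfold-suc-b) (≤-trans (Ack-monoʳ-≤ a′ b′<Y) (Ack-monoˡ-≤ Y a′≤c))
    where
    open ≤-Reasoning
    X Y : ℕ
    X = iter (suc k) (A a′) (A (suc a′) (x ∸ 1))
    Y = iter (suc k) (A c) x

    unfold-x : A (suc a′) x ≡ A a′ X
    unfold-x = Ack-suc-unfold a′ (subst (0 <_) (sym x≡) (≤-<-trans z≤n (Ack-inflationary (suc c) b)))

    unfold-suc-b : A (suc c) (suc b) ≡ A c Y
    unfold-suc-b = cong (λ z → A c (iter (suc k) (A c) z)) (sym x≡)

    b′<X : b′ < X
    b′<X = Ack-cancelʳ-< a′ (≤-<-trans lowB (subst (m <_) unfold-x upA))

    b′<Y : b′ < Y
    b′<Y with m≤n⇒m<n∨m≡n a′≤c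
    ... | inj₂ refl = Ack-cancelʳ-< c (≤-<-trans lowB (subst (m <_) unfold-suc-b upB))
    ... | inj₁ a′<c = begin-strict
      b′             <⟨ b′<X ⟩
      X              <⟨ Ack-inflationary a′ X ⟩
      A a′ X         ≡⟨ unfold-x ⟨
      A (suc a′) x   ≤⟨ Ack-monoˡ-≤ x a′<c ⟩
      A c x          ≤⟨ Ack-monoʳ-≤ c (iter-inflationary (A c) (Ack-inflationary c) k x) ⟩
      Y              ∎

  sandwich-bounds : ∀ {a a′ b b′ x m} → x ≡ A a b →
    A a′ x ≤ m → m < A (suc a′) x → A a′ b′ ≤ m → m < A a (suc b) →
      (b′ < iter (suc k) (A a′) (A (suc a′) (x ∸ 1)) ⊓ iter (suc k) (A (a ∸ 1)) x)
      × A a′ (suc b′) ≤ A (suc a′) x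
      × A a′ (suc b′) ≤ A a (suc b)
  sandwich-bounds {a} {a′} {b} x≡ lowA upA lowB upB
    with sandwich-index-decreases {a} {a′} {b} x≡ lowA upB
  ... | s≤s a′≤c = sandwich-bounds-below {b = b} a′≤c x≡ upA lowB upB

lemma3p2 : (k : ℕ) → 2 ≤ k → (m : ℕ) → 0 < m → (n : ℕ) → (a b ms : ℕ → ℕ) →
    Sandwiching k m n a b ms →
    (i : ℕ) → 1 ≤ i → i < n →
      (b (suc i) < (iter (k ∸ 1) (Ack k (a (suc i))) (Ack k (suc (a (suc i))) (ms i ∸ 1))
                    ⊓ iter (k ∸ 1) (Ack k (a i ∸ 1)) (ms i)))
      × (Ack k (a (suc i)) (suc (b (suc i))) ≤ Ack k (suc (a (suc i))) (ms i))
      × (Ack k (a (suc i)) (suc (b (suc i))) ≤ Ack k (a i) (suc (b i)))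
lemma3p2 (suc (suc k)) (s≤s (s≤s _)) m _ n a b ms S (suc j) _ i<n =
  sandwich-bounds k {a i} {a (suc i)} {b i} {b (suc i)}
    (step j j<n) (lowA i i<n) (upA i i<n) (lowB i i<n) (upB j j<n)
  where
  open Sandwiching S
  i : ℕ
  i = suc j
  j<n : j < n
  j<n = <-trans (n<1+n j) i<n
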